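{- For every power $q$ of an odd prime, $|Z(\mathbb{F}_q)|=(q-1)|F(\mathbb{F}_q)|+2q+2$.
   Context: $Z\subset\mathbb{P}^7$, with coordinates $[Y_0:Y_1:Y_2:Y_3:X_0:X_1:X_2:X_3]$, is defined by $Y_0^2=2(X_0X_3+X_1X_2)$, $Y_1^2=2(X_0X_3-X_1X_2)$, $Y_2^2=2(X_0X_2-X_1X_3)$, $Y_3^2=2(X_0X_2+X_1X_3)$; $F\subset\mathbb{P}^3$ is the Fermat quartic $Z_0^4-Z_1^4+Z_2^4-Z_3^4=0$. -}

module Defs where

open import Data.Nat using (ℕ; zero; suc)
open import Data.Fin using (Fin)
open import Data.Bool using (Bool; true; false; if_then_else_; _∧_)
open import Data.List using (List; []; _∷_; map; concatMap; length; filterᵇ; allFin)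
open import Data.Vec using (Vec; []; _∷_)
open import Data.Product using (Σ)
open import Relation.Nullary using (¬_; Dec; does)
open import Relation.Binary.PropositionalEquality using (_≡_)
open import Function.Bundles using (_↔_; Inverse)
open import Algebra.Structures using (IsCommutativeRing)

record FiniteField : Set₁ where
  infixl 6 _+_ _-_
  infixl 7 _*_
  field
    Carrier : Set
    _+_ _*_ : Carrier → Carrier → Carrier
    -_ : Carrier → Carrier
    0# 1# : Carrier
    isCommutativeRing : IsCommutativeRing _≡_ _+_ _*_ -_ 0# 1#
    0≢1 : ¬ (0# ≡ 1#)
    inverse : (x : Carrier) → ¬ (x ≡ 0#) → Σ Carrier (λ y → x * y ≡ 1#)
    _≟_ : (x y : Carrier) → Dec (x ≡ y)
    size : ℕ
    enumeration : Fin size ↔ Carrier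

  _-_ : Carrier → Carrier → Carrier
  x - y = x + (- y)

  2# : Carrier
  2# = 1# + 1#

  _²  : Carrier → Carrier
  x ² = x * x

  _⁴ : Carrier → Carrier
  x ⁴ = (x * x) * (x * x)

  _==_ : Carrier → Carrier → Bool
  x == y = does (x ≟ y)

  elements : List Carrier
  elements = map (Inverse.to enumeration) (allFin size)

  allVecs : (n : ℕ) → List (Vec Carrier n)
  allVecs zero = [] ∷ []
  allVecs (suc n) = concatMap (λ x → map (x ∷_) (allVecs n)) elements

  -- Normalised representative of a point of projective space:
  -- nonzero vector whose first nonzero coordinate equals 1.
  -- Each point of P^{n-1}(K) has exactly one such representative.
  normalised : {n : ℕ} → Vec Carrier n → Bool
  normalised [] = false
  normalised (x ∷ xs) = if x == 0# then normalised xs else (x == 1#)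

  projPoints : (n : ℕ) → (Vec Carrier n → Bool) → ℕ
  projPoints n eqs = length (filterᵇ (λ v → normalised v ∧ eqs v) (allVecs n))

  Zeqs : Vec Carrier 8 → Bool
  Zeqs (y0 ∷ y1 ∷ y2 ∷ y3 ∷ x0 ∷ x1 ∷ x2 ∷ x3 ∷ []) =
       ((y0 ²) == (2# * (x0 * x3 + x1 * x2)))
    ∧ (((y1 ²) == (2# * (x0 * x3 - x1 * x2)))
    ∧ (((y2 ²) == (2# * (x0 * x2 - x1 * x3)))
    ∧  ((y3 ²) == (2# * (x0 * x2 + x1 * x3)))))

  Feqs : Vec Carrier 4 → Bool
  Feqs (z0 ∷ z1 ∷ z2 ∷ z3 ∷ []) = ((((z0 ⁴) - (z1 ⁴)) + (z2 ⁴)) - (z3 ⁴)) == 0#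

  #Z : ℕ
  #Z = projPoints 8 Zeqs

  #F : ℕ
  #F = projPoints 4 Feqs

module Submission where

-- Fix y = (y0, y1, y2, y3) ≠ 0. Since q is odd, 2 is invertible, and the four equations of Z say
-- exactly that the rank-one matrix (x0, x1)ᵀ (x2, x3) equals a matrix M(y) whose entries are
-- (y3² ± y2²)/4 and (y0² ± y1²)/4, with det M(y) = −(y0⁴ − y1⁴ + y2⁴ − y3⁴)/16. A nonzero 2 × 2
-- matrix has q − 1 such factorisations when it is singular and none otherwise, so every point of F
-- carries q − 1 points of Z and no other y ≠ 0 carries any. Over y = 0 the condition is
-- (x0, x1)ᵀ (x2, x3) = 0, whose solutions in P³ are the two skew lines x0 = x1 = 0 and
-- x2 = x3 = 0, another 2(q + 1) points.

open import Defs
open import Algebra.Bundles using (CommutativeRing; RawRing)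
open import Algebra.Solver.Ring.AlmostCommutativeRing using (fromCommutativeRing; _-Raw-AlmostCommutative⟶_)
open import Data.Bool using (Bool; true; false; if_then_else_; _∧_)
open import Data.Empty using (⊥-elim)
open import Data.Fin using (Fin; zero; suc)
import Data.Fin.Properties as Fin
open import Data.Fin.Permutation using (Permutation′; permutation)
open import Data.List as List using (List; map; concatMap; filterᵇ; length; _++_; tabulate; allFin)
import Data.List.Properties as Listₚ
open import Data.Maybe using (Maybe; just; nothing)
open import Data.Nat as ℕ using (ℕ; zero; suc)
import Data.Nat.Properties as ℕ
open import Data.Nat.Divisibility using (_∣_; divides; ∣1⇒≡1)
open import Data.Nat.ListAction using () renaming (sum to sumᴸ)
open import Data.Nat.ListAction.Properties using (sum-++)
open import Data.Nat.Primality using (Prime; euclidsLemma; prime[2]; ¬prime[1]; prime⇒irreducible)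
open import Data.Nat.Tactic.RingSolver using (solve-∀)
open import Data.Product using (_×_; _,_; ∃-syntax; uncurry)
open import Data.Product.Properties using (≡-dec)
open import Data.Sum using (inj₁; inj₂)
open import Data.Vec as Vec using (Vec; []; _∷_; replicate)
import Data.Vec.Properties as Vec
open import Function using (_∘_; id; _↔_; Inverse; mk↔ₛ′; _⇔_; mk⇔; Equivalence)
open import Relation.Binary using (tri<; tri≈; tri>)
open import Relation.Binary.Definitions using (DecidableEquality)
open import Relation.Binary.PropositionalEquality
open import Relation.Nullary using (¬_; Dec; does; yes; no)
open import Relation.Nullary.Decidable using (_×-dec_; dec-true; dec-false; does-⇔)
open import Algebra.Properties.Semiring.Sum ℕ.+-*-semiring
  using (sum; sum-cong-≗; sum-replicate-zero; ∑-distrib-+; *-distribˡ-sum; ∑-permute; ∑-comm)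

toℕ : Bool → ℕ
toℕ b = if b then 1 else 0

sum-const : ∀ m c → sum {m} (λ _ → c) ≡ m ℕ.* c
sum-const zero c = refl
sum-const (suc m) c = cong (c ℕ.+_) (sum-const m c)

sum-support : ∀ {m} (t : Fin m → ℕ) i → (∀ j → j ≢ i → t j ≡ 0) → sum t ≡ t i
sum-support {suc m} t zero t≡0 =
  trans (cong (t zero ℕ.+_) (trans (sum-cong-≗ (λ j → t≡0 (suc j) λ ())) (sum-replicate-zero m))) (ℕ.+-identityʳ _)
sum-support t (suc i) t≡0 =
  cong₂ ℕ._+_ (t≡0 zero λ ()) (sum-support (t ∘ suc) i (λ j j≢i → t≡0 (suc j) (j≢i ∘ Fin.suc-injective)))

sum-tabulate : ∀ {m} (f : Fin m → ℕ) → sumᴸ (tabulate f) ≡ sum f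
sum-tabulate {zero} f = refl
sum-tabulate {suc m} f = cong (f zero ℕ.+_) (sum-tabulate (f ∘ suc))

length-filterᵇ : ∀ {A : Set} (p : A → Bool) xs → length (filterᵇ p xs) ≡ sumᴸ (map (toℕ ∘ p) xs)
length-filterᵇ p List.[] = refl
length-filterᵇ p (x List.∷ xs) with p x
... | true = cong suc (length-filterᵇ p xs)
... | false = length-filterᵇ p xs

sum-map-concatMap : ∀ {A B : Set} (f : B → ℕ) (g : A → List B) xs →
                    sumᴸ (map f (concatMap g xs)) ≡ sumᴸ (map (λ x → sumᴸ (map f (g x))) xs)
sum-map-concatMap f g List.[] = refl
sum-map-concatMap f g (x List.∷ xs) = begin
  sumᴸ (map f (g x ++ concatMap g xs))                 ≡⟨ cong sumᴸ (Listₚ.map-++ f (g x) _) ⟩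
  sumᴸ (map f (g x) ++ map f (concatMap g xs))         ≡⟨ sum-++ (map f (g x)) _ ⟩
  sumᴸ (map f (g x)) ℕ.+ sumᴸ (map f (concatMap g xs)) ≡⟨ cong (sumᴸ (map f (g x)) ℕ.+_) (sum-map-concatMap f g xs) ⟩
  sumᴸ (map f (g x)) ℕ.+ sumᴸ (map (λ x → sumᴸ (map f (g x))) xs) ∎
  where open ≡-Reasoning

module IntegerCoefficientSolver {c ℓ} (R : CommutativeRing c ℓ) where
  open CommutativeRing R hiding (setoid) renaming (refl to ≈-refl; sym to ≈-sym; trans to ≈-trans)
  open import Algebra.Properties.Ring ring using (-‿involutive; -‿distribˡ-*; -‿distribʳ-*)
  open import Algebra.Properties.AbelianGroup +-abelianGroup using (⁻¹-∙-comm; ⁻¹-anti-homo‿-)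
  open import Algebra.Properties.Group +-group using (ε⁻¹≈ε)
  open import Algebra.Properties.Semiring.Mult.TCOptimised semiring using (×-homo-+; ×1-homo-*) renaming (_×_ to _×′_)
  open import Relation.Binary.Reasoning.Setoid (CommutativeRing.setoid R)
  import Algebra.Solver.Ring.NaturalCoefficients.Default commutativeSemiring as SemiringSolver

  -- A coefficient (m , n) stands for the integer m − n. The solver compares coefficients by
  -- computation, so the arithmetic below keeps them normalised (one entry zero).
  norm : ℕ × ℕ → ℕ × ℕ
  norm (suc m , suc n) = norm (m , n)
  norm d = d

  _+ℤ_ _*ℤ_ : ℕ × ℕ → ℕ × ℕ → ℕ × ℕ
  (m , n) +ℤ (m′ , n′) = norm (m ℕ.+ m′ , n ℕ.+ n′)
  (m , n) *ℤ (m′ , n′) = norm (m ℕ.* m′ ℕ.+ n ℕ.* n′ , m ℕ.* n′ ℕ.+ n ℕ.* m′)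

  ι : ℕ → Carrier
  ι n = n ×′ 1#

  -- Chosen so that con (2 , 0) evaluates to 1# + 1#, which is 2# on the nose.
  ⟦_⟧ : ℕ × ℕ → Carrier
  ⟦ m , zero ⟧ = ι m
  ⟦ zero , suc n ⟧ = - ι (suc n)
  ⟦ suc m , suc n ⟧ = ⟦ m , n ⟧

  ⟦norm⟧ : ∀ d → ⟦ norm d ⟧ ≡ ⟦ d ⟧
  ⟦norm⟧ (zero , n) = refl
  ⟦norm⟧ (suc m , zero) = refl
  ⟦norm⟧ (suc m , suc n) = ⟦norm⟧ (m , n)

  -‿+-distrib : ∀ x y → - (x + y) ≈ - x + - y
  -‿+-distrib x y = ≈-sym (⁻¹-∙-comm x y)

  -‿-‿*-cancel : ∀ x y → - x * - y ≈ x * y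
  -‿-‿*-cancel x y = begin
    - x * - y       ≈⟨ -‿distribˡ-* x (- y) ⟨
    - (x * - y)     ≈⟨ -‿cong (-‿distribʳ-* x y) ⟨
    - (- (x * y))   ≈⟨ -‿involutive (x * y) ⟩
    x * y           ∎

  difference-of-sums : ∀ a b c d → (a + c) - (b + d) ≈ (a - b) + (c - d)
  difference-of-sums a b c d = begin
    (a + c) - (b + d)     ≈⟨ +-congˡ (-‿+-distrib b d) ⟩
    (a + c) + (- b + - d) ≈⟨ solve 4 (λ a c b′ d′ → (a :+ c) :+ (b′ :+ d′) := (a :+ b′) :+ (c :+ d′))
                                      ≈-refl a c (- b) (- d) ⟩
    (a - b) + (c - d)     ∎
    where open SemiringSolver

  product-of-differences : ∀ a b c d → (a * c + b * d) - (a * d + b * c) ≈ (a - b) * (c - d)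
  product-of-differences a b c d = begin
    (a * c + b * d) - (a * d + b * c)
      ≈⟨ +-cong (+-congˡ (≈-sym (-‿-‿*-cancel b d))) (-‿+-distrib (a * d) (b * c)) ⟩
    (a * c + - b * - d) + (- (a * d) + - (b * c))
      ≈⟨ +-congˡ (+-cong (-‿distribʳ-* a d) (-‿distribˡ-* b c)) ⟩
    (a * c + - b * - d) + (a * - d + - b * c)
      ≈⟨ solve 4 (λ a b′ c d′ → (a :* c :+ b′ :* d′) :+ (a :* d′ :+ b′ :* c) := (a :+ b′) :* (c :+ d′))
                 ≈-refl a (- b) c (- d) ⟩
    (a - b) * (c - d)                             ∎
    where open SemiringSolver

  ⟦⟧≈ι-ι : ∀ m n → ⟦ m , n ⟧ ≈ ι m - ι n
  ⟦⟧≈ι-ι m zero = ≈-sym (≈-trans (+-congˡ ε⁻¹≈ε) (+-identityʳ _))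
  ⟦⟧≈ι-ι zero (suc n) = ≈-sym (+-identityˡ _)
  ⟦⟧≈ι-ι (suc m) (suc n) = begin
    ⟦ m , n ⟧                   ≈⟨ ⟦⟧≈ι-ι m n ⟩
    ι m - ι n                   ≈⟨ +-identityˡ _ ⟨
    0# + (ι m - ι n)            ≈⟨ +-congʳ (-‿inverseʳ 1#) ⟨
    (1# - 1#) + (ι m - ι n)     ≈⟨ difference-of-sums 1# 1# (ι m) (ι n) ⟨
    (1# + ι m) - (1# + ι n)     ≈⟨ +-cong (≈-sym (×-homo-+ 1# 1 m)) (-‿cong (≈-sym (×-homo-+ 1# 1 n))) ⟩
    ι (suc m) - ι (suc n)       ∎

  ⟦⟧-homo-+ : ∀ d e → ⟦ d +ℤ e ⟧ ≈ ⟦ d ⟧ + ⟦ e ⟧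
  ⟦⟧-homo-+ (m , n) (m′ , n′) = begin
    ⟦ norm (m ℕ.+ m′ , n ℕ.+ n′) ⟧  ≡⟨ ⟦norm⟧ (m ℕ.+ m′ , n ℕ.+ n′) ⟩
    ⟦ m ℕ.+ m′ , n ℕ.+ n′ ⟧        ≈⟨ ⟦⟧≈ι-ι (m ℕ.+ m′) (n ℕ.+ n′) ⟩
    ι (m ℕ.+ m′) - ι (n ℕ.+ n′)    ≈⟨ +-cong (×-homo-+ 1# m m′) (-‿cong (×-homo-+ 1# n n′)) ⟩
    (ι m + ι m′) - (ι n + ι n′)    ≈⟨ difference-of-sums (ι m) (ι n) (ι m′) (ι n′) ⟩
    (ι m - ι n) + (ι m′ - ι n′)    ≈⟨ +-cong (⟦⟧≈ι-ι m n) (⟦⟧≈ι-ι m′ n′) ⟨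
    ⟦ m , n ⟧ + ⟦ m′ , n′ ⟧        ∎

  ⟦⟧-homo-* : ∀ d e → ⟦ d *ℤ e ⟧ ≈ ⟦ d ⟧ * ⟦ e ⟧
  ⟦⟧-homo-* (m , n) (m′ , n′) = begin
    ⟦ norm (p , q) ⟧                                        ≡⟨ ⟦norm⟧ (p , q) ⟩
    ⟦ p , q ⟧                                               ≈⟨ ⟦⟧≈ι-ι p q ⟩
    ι p - ι q                                               ≈⟨ +-cong (ι-+-* m m′ n n′) (-‿cong (ι-+-* m n′ n m′)) ⟩
    (ι m * ι m′ + ι n * ι n′) - (ι m * ι n′ + ι n * ι m′)   ≈⟨ product-of-differences (ι m) (ι n) (ι m′) (ι n′) ⟩
    (ι m - ι n) * (ι m′ - ι n′)                             ≈⟨ *-cong (⟦⟧≈ι-ι m n) (⟦⟧≈ι-ι m′ n′) ⟨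
    ⟦ m , n ⟧ * ⟦ m′ , n′ ⟧                                 ∎
    where
    p q : ℕ
    p = m ℕ.* m′ ℕ.+ n ℕ.* n′
    q = m ℕ.* n′ ℕ.+ n ℕ.* m′
    ι-+-* : ∀ a b c d → ι (a ℕ.* b ℕ.+ c ℕ.* d) ≈ ι a * ι b + ι c * ι d
    ι-+-* a b c d = ≈-trans (×-homo-+ 1# (a ℕ.* b) (c ℕ.* d)) (+-cong (×1-homo-* a b) (×1-homo-* c d))

  ⟦⟧-homo-- : ∀ m n → ⟦ n , m ⟧ ≈ - ⟦ m , n ⟧
  ⟦⟧-homo-- m n = begin
    ⟦ n , m ⟧       ≈⟨ ⟦⟧≈ι-ι n m ⟩
    ι n - ι m       ≈⟨ ⁻¹-anti-homo‿- (ι m) (ι n) ⟨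
    - (ι m - ι n)   ≈⟨ -‿cong (⟦⟧≈ι-ι m n) ⟨
    - ⟦ m , n ⟧     ∎

  ℤ-rawRing : RawRing _ _
  ℤ-rawRing = record
    { Carrier = ℕ × ℕ ; _≈_ = _≡_ ; _+_ = _+ℤ_ ; _*_ = _*ℤ_ ; -_ = λ (m , n) → n , m ; 0# = 0 , 0 ; 1# = 1 , 0 }

  ⟦⟧-homomorphism : ℤ-rawRing -Raw-AlmostCommutative⟶ fromCommutativeRing R
  ⟦⟧-homomorphism = record
    { ⟦_⟧ = ⟦_⟧ ; +-homo = ⟦⟧-homo-+ ; *-homo = ⟦⟧-homo-* ; -‿homo = uncurry ⟦⟧-homo--
    ; 0-homo = ≈-refl ; 1-homo = ≈-refl }

  _≟ℤ_ : ∀ d e → Maybe (⟦ d ⟧ ≈ ⟦ e ⟧)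
  d ≟ℤ e with ≡-dec ℕ._≟_ ℕ._≟_ d e
  ... | yes refl = just ≈-refl
  ... | no _ = nothing

  open import Algebra.Solver.Ring ℤ-rawRing (fromCommutativeRing R) ⟦⟧-homomorphism _≟ℤ_ public
    using (solve; _:=_; _:+_; _:*_; _:-_; con)

module FiniteSums {ℓ} {A : Set ℓ} {n : ℕ} (enumeration : Fin n ↔ A) (_≟_ : DecidableEquality A) where
  open Inverse enumeration using (to; from) renaming (strictlyInverseˡ to to∘from; strictlyInverseʳ to from∘to)
  open import Data.Nat using (_+_; _*_; _∸_)
  open ≡-Reasoning

  ∑ₓ : (A → ℕ) → ℕ
  ∑ₓ f = sum (f ∘ to)

  ∑ₓ-cong : ∀ {f g} → (∀ x → f x ≡ g x) → ∑ₓ f ≡ ∑ₓ g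
  ∑ₓ-cong f≗g = sum-cong-≗ (f≗g ∘ to)

  ∑ₓ-const : ∀ c → ∑ₓ (λ _ → c) ≡ n * c
  ∑ₓ-const = sum-const n

  ∑ₓ-distrib-+ : ∀ f g → ∑ₓ (λ x → f x + g x) ≡ ∑ₓ f + ∑ₓ g
  ∑ₓ-distrib-+ f g = ∑-distrib-+ (f ∘ to) (g ∘ to)

  ∑ₓ-comm : ∀ (f : A → A → ℕ) → ∑ₓ (λ x → ∑ₓ (λ y → f x y)) ≡ ∑ₓ (λ y → ∑ₓ (λ x → f x y))
  ∑ₓ-comm f = ∑-comm {n} {n} (λ i j → f (to i) (to j))

  *-distribˡ-∑ₓ : ∀ c f → c * ∑ₓ f ≡ ∑ₓ (λ x → c * f x)
  *-distribˡ-∑ₓ c f = *-distribˡ-sum c (f ∘ to)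

  ∑ₓ-support : ∀ {f} a → (∀ x → x ≢ a → f x ≡ 0) → ∑ₓ f ≡ f a
  ∑ₓ-support {f} a f≡0 = trans
    (sum-support (f ∘ to) (from a) (λ i i≢ → f≡0 (to i) λ eq → i≢ (trans (sym (from∘to i)) (cong from eq))))
    (cong f (to∘from a))

  ∑ₓ-support₂ : ∀ {f a b} → a ≢ b → (∀ x → x ≢ a → x ≢ b → f x ≡ 0) → ∑ₓ f ≡ f a + f b
  ∑ₓ-support₂ {f} {a} {b} a≢b f≡0 = begin
    ∑ₓ f                    ≡⟨ ∑ₓ-cong split ⟩
    ∑ₓ (λ x → g x + h x)    ≡⟨ ∑ₓ-distrib-+ g h ⟩
    ∑ₓ g + ∑ₓ h             ≡⟨ cong₂ _+_ (∑ₓ-support a g≡0) (∑ₓ-support b h≡0) ⟩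
    g a + h b               ≡⟨ cong₂ _+_ (cong (λ t → if t then f a else 0) (dec-true (a ≟ a) refl))
                                         (cong (λ t → if t then 0 else f b) (dec-false (b ≟ a) (a≢b ∘ sym))) ⟩
    f a + f b               ∎
    where
    g h : A → ℕ
    g x = if does (x ≟ a) then f x else 0
    h x = if does (x ≟ a) then 0 else f x
    split : ∀ x → f x ≡ g x + h x
    split x with does (x ≟ a)
    ... | true = sym (ℕ.+-identityʳ (f x))
    ... | false = refl
    g≡0 : ∀ x → x ≢ a → g x ≡ 0
    g≡0 x x≢a rewrite dec-false (x ≟ a) x≢a = refl
    h≡0 : ∀ x → x ≢ b → h x ≡ 0
    h≡0 x x≢b with x ≟ a
    ... | yes _ = refl
    ... | no x≢a = f≡0 x x≢a x≢b

  ∑ₓ-punctured : ∀ {f} a c → f a ≡ 0 → (∀ x → x ≢ a → f x ≡ c) → ∑ₓ f ≡ (n ∸ 1) * c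
  ∑ₓ-punctured {f} a c fa≡0 f≡c = begin
    ∑ₓ f                       ≡⟨ ℕ.m+n∸n≡m (∑ₓ f) c ⟨
    ∑ₓ f + c ∸ c               ≡⟨ cong (λ s → ∑ₓ f + s ∸ c) ∑ₓδ≡c ⟨
    ∑ₓ f + ∑ₓ δ ∸ c            ≡⟨ cong (_∸ c) (∑ₓ-distrib-+ f δ) ⟨
    ∑ₓ (λ x → f x + δ x) ∸ c   ≡⟨ cong (_∸ c) (trans (∑ₓ-cong f+δ≡c) (∑ₓ-const c)) ⟩
    n * c ∸ c                  ≡⟨ cong (n * c ∸_) (ℕ.*-identityˡ c) ⟨
    n * c ∸ 1 * c              ≡⟨ ℕ.*-distribʳ-∸ c n 1 ⟨
    (n ∸ 1) * c                ∎
    where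
    δ : A → ℕ
    δ x = if does (x ≟ a) then c else 0
    ∑ₓδ≡c : ∑ₓ δ ≡ c
    ∑ₓδ≡c = trans (∑ₓ-support a (λ x x≢a → cong (λ t → if t then c else 0) (dec-false (x ≟ a) x≢a)))
                  (cong (λ t → if t then c else 0) (dec-true (a ≟ a) refl))
    f+δ≡c : ∀ x → f x + δ x ≡ c
    f+δ≡c x with x ≟ a
    ... | yes refl = cong (_+ c) fa≡0
    ... | no x≢a = trans (ℕ.+-identityʳ (f x)) (f≡c x x≢a)

  ∑ₓ-reindex : ∀ (σ : A ↔ A) f → ∑ₓ (f ∘ Inverse.to σ) ≡ ∑ₓ f
  ∑ₓ-reindex σ f = sym (trans (∑-permute (f ∘ to) π) (sum-cong-≗ (λ i → cong f (to∘from (σ→ (to i))))))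
    where
    open Inverse σ renaming (to to σ→; from to σ←)
    π : Permutation′ n
    π = permutation (from ∘ σ→ ∘ to) (from ∘ σ← ∘ to)
          (λ i → trans (cong (from ∘ σ→) (to∘from _)) (trans (cong from (strictlyInverseˡ _)) (from∘to i)))
          (λ i → trans (cong (from ∘ σ←) (to∘from _)) (trans (cong from (strictlyInverseʳ _)) (from∘to i)))

  -- Of x and σ x, exactly one has the smaller index.
  fixedPointFree-involution⇒even : ∀ (σ : A → A) → (∀ x → σ (σ x) ≡ x) → (∀ x → σ x ≢ x) → ∃[ m ] n ≡ 2 * m
  fixedPointFree-involution⇒even σ σσ≡id σx≢x = ∑ₓ before , (begin
    n                                    ≡⟨ ℕ.*-identityʳ n ⟨
    n * 1                                ≡⟨ ∑ₓ-const 1 ⟨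
    ∑ₓ (λ _ → 1)                         ≡⟨ ∑ₓ-cong exactly-one ⟨
    ∑ₓ (λ x → before x + before (σ x))   ≡⟨ ∑ₓ-distrib-+ before (before ∘ σ) ⟩
    ∑ₓ before + ∑ₓ (before ∘ σ)          ≡⟨ cong (∑ₓ before +_) (∑ₓ-reindex (mk↔ₛ′ σ σ σσ≡id σσ≡id) before) ⟩
    ∑ₓ before + ∑ₓ before                ≡⟨ cong (∑ₓ before +_) (ℕ.+-identityʳ _) ⟨
    2 * ∑ₓ before                        ∎)
    where
    before : A → ℕ
    before x = toℕ (does (from x Fin.<? from (σ x)))
    exactly-one : ∀ x → before x + before (σ x) ≡ 1
    exactly-one x rewrite σσ≡id x with Fin.<-cmp (from x) (from (σ x))
    ... | tri< i<j _ j≮i rewrite dec-true (from x Fin.<? from (σ x)) i<j | dec-false (from (σ x) Fin.<? from x) j≮i = refl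
    ... | tri> i≮j _ j<i rewrite dec-false (from x Fin.<? from (σ x)) i≮j | dec-true (from (σ x) Fin.<? from x) j<i = refl
    ... | tri≈ _ i≡j _ = ⊥-elim (σx≢x x (trans (sym (to∘from (σ x))) (trans (cong to (sym i≡j)) (to∘from x))))

module PointCounting (K : FiniteField) where
  open FiniteField K using (Carrier; 0#; 1#; 0≢1; _≟_; size; enumeration; elements; allVecs; normalised; projPoints)
  open FiniteSums enumeration _≟_ public
  open import Data.Nat using (_+_; _*_)
  open ≡-Reasoning

  ∑ᵛ : ∀ m → (Vec Carrier m → ℕ) → ℕ
  ∑ᵛ zero f = f []
  ∑ᵛ (suc m) f = ∑ₓ λ x → ∑ᵛ m (λ v → f (x ∷ v))

  count : ∀ m → (Vec Carrier m → Bool) → ℕ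
  count m P = ∑ᵛ m (toℕ ∘ P)

  projCount : ∀ m → (Vec Carrier m → Bool) → ℕ
  projCount m P = count m (λ v → normalised v ∧ P v)

  ∑ₓ-elements : ∀ f → sumᴸ (map f elements) ≡ ∑ₓ f
  ∑ₓ-elements f = begin
    sumᴸ (map f (map to (allFin size)))   ≡⟨ cong (sumᴸ ∘ map f) (Listₚ.map-tabulate id to) ⟩
    sumᴸ (map f (tabulate to))           ≡⟨ cong sumᴸ (Listₚ.map-tabulate to f) ⟩
    sumᴸ (tabulate (f ∘ to))             ≡⟨ sum-tabulate (f ∘ to) ⟩
    ∑ₓ f                                 ∎
    where open Inverse enumeration using (to)

  sum-allVecs : ∀ m (f : Vec Carrier m → ℕ) → sumᴸ (map f (allVecs m)) ≡ ∑ᵛ m f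
  sum-allVecs zero f = ℕ.+-identityʳ (f [])
  sum-allVecs (suc m) f = begin
    sumᴸ (map f (concatMap (λ x → map (x ∷_) (allVecs m)) elements)) ≡⟨ sum-map-concatMap f _ elements ⟩
    sumᴸ (map (λ x → sumᴸ (map f (map (x ∷_) (allVecs m)))) elements) ≡⟨ ∑ₓ-elements _ ⟩
    ∑ₓ (λ x → sumᴸ (map f (map (x ∷_) (allVecs m))))
      ≡⟨ ∑ₓ-cong (λ x → cong sumᴸ (Listₚ.map-∘ {g = f} {f = x ∷_} (allVecs m))) ⟨
    ∑ₓ (λ x → sumᴸ (map (λ v → f (x ∷ v)) (allVecs m)))             ≡⟨ ∑ₓ-cong (λ x → sum-allVecs m (λ v → f (x ∷ v))) ⟩
    ∑ₓ (λ x → ∑ᵛ m (λ v → f (x ∷ v)))                              ∎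

  projPoints≡projCount : ∀ m P → projPoints m P ≡ projCount m P
  projPoints≡projCount m P = trans (length-filterᵇ _ (allVecs m)) (sum-allVecs m _)

  ∑ᵛ-cong : ∀ m {f g} → (∀ v → f v ≡ g v) → ∑ᵛ m f ≡ ∑ᵛ m g
  ∑ᵛ-cong zero f≗g = f≗g []
  ∑ᵛ-cong (suc m) f≗g = ∑ₓ-cong (λ x → ∑ᵛ-cong m (λ v → f≗g (x ∷ v)))

  count-cong : ∀ m {P Q} → (∀ v → P v ≡ Q v) → count m P ≡ count m Q
  count-cong m P≗Q = ∑ᵛ-cong m (λ v → cong toℕ (P≗Q v))

  projCount-cong : ∀ m {P Q} → (∀ v → P v ≡ Q v) → projCount m P ≡ projCount m Q
  projCount-cong m P≗Q = ∑ᵛ-cong m (λ v → cong (λ b → toℕ (normalised v ∧ b)) (P≗Q v))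

  ∑ᵛ-support : ∀ {m f} v₀ → (∀ v → v ≢ v₀ → f v ≡ 0) → ∑ᵛ m f ≡ f v₀
  ∑ᵛ-support [] f≡0 = refl
  ∑ᵛ-support {suc m} (a ∷ v₀) f≡0 = trans
    (∑ₓ-support a (λ x x≢a → trans (∑ᵛ-support v₀ (λ v _ → f≡0 (x ∷ v) (x≢a ∘ Vec.∷-injectiveˡ)))
                                    (f≡0 (x ∷ v₀) (x≢a ∘ Vec.∷-injectiveˡ))))
    (∑ᵛ-support v₀ (λ v v≢v₀ → f≡0 (a ∷ v) (v≢v₀ ∘ Vec.∷-injectiveʳ)))

  ∑ᵛ-zero : ∀ {m f} → (∀ v → f v ≡ 0) → ∑ᵛ m f ≡ 0
  ∑ᵛ-zero {m} f≡0 = trans (∑ᵛ-support (replicate m 0#) (λ v _ → f≡0 v)) (f≡0 _)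

  *-distribˡ-∑ᵛ : ∀ m c f → c * ∑ᵛ m f ≡ ∑ᵛ m (λ v → c * f v)
  *-distribˡ-∑ᵛ zero c f = refl
  *-distribˡ-∑ᵛ (suc m) c f =
    trans (*-distribˡ-∑ₓ c (λ x → ∑ᵛ m (λ v → f (x ∷ v))))
          (∑ₓ-cong (λ x → *-distribˡ-∑ᵛ m c (λ v → f (x ∷ v))))

  ∑ᵛ-++ : ∀ m n f → ∑ᵛ (m + n) f ≡ ∑ᵛ m (λ u → ∑ᵛ n (λ v → f (u Vec.++ v)))
  ∑ᵛ-++ zero n f = refl
  ∑ᵛ-++ (suc m) n f = ∑ₓ-cong (λ x → ∑ᵛ-++ m n (λ w → f (x ∷ w)))

  swap₀₁ : ∀ {m} → Vec Carrier (2 + m) → Vec Carrier (2 + m)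
  swap₀₁ (x ∷ y ∷ v) = y ∷ x ∷ v

  ∑ᵛ-swap₀₁ : ∀ m f → ∑ᵛ (2 + m) (f ∘ swap₀₁) ≡ ∑ᵛ (2 + m) f
  ∑ᵛ-swap₀₁ m f = ∑ₓ-comm (λ x y → ∑ᵛ m (λ v → f (y ∷ x ∷ v)))

  -- A normalised vector starts with 0 (the hyperplane at infinity) or with 1 (the affine chart).
  projCount-suc : ∀ m P → projCount (suc m) P ≡ projCount m (λ v → P (0# ∷ v)) + count m (λ v → P (1# ∷ v))
  projCount-suc m P = trans (∑ₓ-support₂ 0≢1 off-charts) (cong₂ _+_ at-0 at-1)
    where
    at-0 : count m (λ v → normalised (0# ∷ v) ∧ P (0# ∷ v)) ≡ projCount m (λ v → P (0# ∷ v))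
    at-0 rewrite dec-true (0# ≟ 0#) refl = refl
    at-1 : count m (λ v → normalised (1# ∷ v) ∧ P (1# ∷ v)) ≡ count m (λ v → P (1# ∷ v))
    at-1 rewrite dec-false (1# ≟ 0#) (0≢1 ∘ sym) | dec-true (1# ≟ 1#) refl = refl
    off-charts : ∀ x → x ≢ 0# → x ≢ 1# → count m (λ v → normalised (x ∷ v) ∧ P (x ∷ v)) ≡ 0
    off-charts x x≢0 x≢1 rewrite dec-false (x ≟ 0#) x≢0 | dec-false (x ≟ 1#) x≢1 = ∑ᵛ-zero {m} (λ _ → refl)

  projCount-fibration : ∀ m n c (E : Vec Carrier (m + n) → Bool) (F : Vec Carrier m → Bool) →
    (∀ y → y ≢ replicate m 0# → count n (λ x → E (y Vec.++ x)) ≡ c * toℕ (F y)) →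
    projCount (m + n) E ≡ c * projCount m F + projCount n (λ x → E (replicate m 0# Vec.++ x))
  projCount-fibration zero n c E F fibre = cong (_+ projCount n E) (sym (ℕ.*-zeroʳ c))
  projCount-fibration (suc m) n c E F fibre = begin
    projCount (suc m + n) E
      ≡⟨ projCount-suc (m + n) E ⟩
    projCount (m + n) (λ w → E (0# ∷ w)) + count (m + n) (λ w → E (1# ∷ w))
      ≡⟨ cong₂ _+_ at-infinity affine-chart ⟩
    (c * projCount m (λ y → F (0# ∷ y)) + Z₀) + c * count m (λ y → F (1# ∷ y))
      ≡⟨ rearrange c _ _ Z₀ ⟩
    c * (projCount m (λ y → F (0# ∷ y)) + count m (λ y → F (1# ∷ y))) + Z₀
      ≡⟨ cong (λ t → c * t + Z₀) (projCount-suc m F) ⟨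
    c * projCount (suc m) F + Z₀ ∎
    where
    Z₀ : ℕ
    Z₀ = projCount n (λ x → E (0# ∷ replicate m 0# Vec.++ x))
    rearrange : ∀ c a b z → (c * a + z) + c * b ≡ c * (a + b) + z
    rearrange = solve-∀
    at-infinity : projCount (m + n) (λ w → E (0# ∷ w)) ≡ c * projCount m (λ y → F (0# ∷ y)) + Z₀
    at-infinity = projCount-fibration m n c _ (λ y → F (0# ∷ y)) (λ y y≢0 → fibre (0# ∷ y) (y≢0 ∘ Vec.∷-injectiveʳ))
    affine-chart : count (m + n) (λ w → E (1# ∷ w)) ≡ c * count m (λ y → F (1# ∷ y))
    affine-chart = begin
      count (m + n) (λ w → E (1# ∷ w))                    ≡⟨ ∑ᵛ-++ m n _ ⟩
      ∑ᵛ m (λ y → count n (λ x → E (1# ∷ y Vec.++ x)))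
        ≡⟨ ∑ᵛ-cong m (λ y → fibre (1# ∷ y) (0≢1 ∘ sym ∘ Vec.∷-injectiveˡ)) ⟩
      ∑ᵛ m (λ y → c * toℕ (F (1# ∷ y)))                   ≡⟨ *-distribˡ-∑ᵛ m c _ ⟨
      c * count m (λ y → F (1# ∷ y))                      ∎

module FieldLemmas (K : FiniteField) where
  open FiniteField K
  open PointCounting K using (fixedPointFree-involution⇒even)

  commutativeRing : CommutativeRing _ _
  commutativeRing = record { isCommutativeRing = isCommutativeRing }

  open CommutativeRing commutativeRing public using (+-assoc; +-identityʳ; *-comm; *-identityˡ; zeroˡ; zeroʳ)
  open IntegerCoefficientSolver commutativeRing public using (solve; _:=_; _:+_; _:*_; _:-_; con)
  open ≡-Reasoning

  unit-cancelˡ : ∀ {x w} → x * w ≡ 1# → ∀ z → (x * w) * z ≡ z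
  unit-cancelˡ xw≡1 z = trans (cong (_* z) xw≡1) (*-identityˡ z)

  unit-solve : ∀ {x w y z} → x * w ≡ 1# → (x * y ≡ z ⇔ y ≡ w * z)
  unit-solve {x} {w} {y} {z} xw≡1 = mk⇔
    (λ xy≡z → begin
      y               ≡⟨ unit-cancelˡ xw≡1 y ⟨
      (x * w) * y     ≡⟨ solve 3 (λ x w y → (x :* w) :* y := w :* (x :* y)) refl x w y ⟩
      w * (x * y)     ≡⟨ cong (w *_) xy≡z ⟩
      w * z           ∎)
    (λ y≡wz → begin
      x * y           ≡⟨ cong (x *_) y≡wz ⟩
      x * (w * z)     ≡⟨ solve 3 (λ x w z → x :* (w :* z) := (x :* w) :* z) refl x w z ⟩
      (x * w) * z     ≡⟨ unit-cancelˡ xw≡1 z ⟩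
      z               ∎)

  nonzero-cancel : ∀ {x y} → x ≢ 0# → x * y ≡ 0# → y ≡ 0#
  nonzero-cancel {x} x≢0 xy≡0 with inverse x x≢0
  ... | w , xw≡1 = trans (Equivalence.to (unit-solve xw≡1) xy≡0) (zeroʳ w)

  square≡0⇒≡0 : ∀ {x} → x ² ≡ 0# → x ≡ 0#
  square≡0⇒≡0 {x} x²≡0 with x ≟ 0#
  ... | yes x≡0 = x≡0
  ... | no x≢0 = nonzero-cancel x≢0 x²≡0

  -- If 2 = 0 then x ↦ x + 1 is a fixed-point-free involution.
  2≢0 : (∀ m → size ≢ 2 ℕ.* m) → 2# ≢ 0#
  2≢0 size-odd 2≡0 = uncurry size-odd (fixedPointFree-involution⇒even (_+ 1#) shift-involutive shift-fixedPointFree)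
    where
    shift-involutive : ∀ x → (x + 1#) + 1# ≡ x
    shift-involutive x = trans (+-assoc x 1# 1#) (trans (cong (x +_) 2≡0) (+-identityʳ x))
    shift-fixedPointFree : ∀ x → x + 1# ≢ x
    shift-fixedPointFree x x+1≡x = 0≢1 (sym (begin
      1#              ≡⟨ solve 1 (λ x → con (1 , 0) := (x :+ con (1 , 0)) :- x) refl x ⟩
      (x + 1#) - x    ≡⟨ cong (_- x) x+1≡x ⟩
      x - x           ≡⟨ solve 1 (λ x → x :- x := con (0 , 0)) refl x ⟩
      0#              ∎))

module Factorisations (K : FiniteField) where
  open FiniteField K
  open PointCounting K
  open FieldLemmas K
  open ≡-Reasoning

  -- (x0, x1)ᵀ (x2, x3) is the matrix ( a b ; c d ).
  Factorises : (a b c d : Carrier) → Vec Carrier 4 → Set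
  Factorises a b c d (x0 ∷ x1 ∷ x2 ∷ x3 ∷ []) = x0 * x2 ≡ a × x0 * x3 ≡ b × x1 * x2 ≡ c × x1 * x3 ≡ d

  factorises? : ∀ a b c d v → Dec (Factorises a b c d v)
  factorises? a b c d (x0 ∷ x1 ∷ x2 ∷ x3 ∷ []) =
    (x0 * x2) ≟ a ×-dec (x0 * x3) ≟ b ×-dec (x1 * x2) ≟ c ×-dec (x1 * x3) ≟ d

  #factorisations : (a b c d : Carrier) → ℕ
  #factorisations a b c d = count 4 (does ∘ factorises? a b c d)

  singular : (a b c d : Carrier) → Bool
  singular a b c d = does ((a * d) ≟ (b * c))

  singular-swapColumns : ∀ a b c d → singular b a d c ≡ singular a b c d
  singular-swapColumns a b c d = does-⇔ (mk⇔ sym sym) ((b * c) ≟ (a * d)) ((a * d) ≟ (b * c))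

  singular-swapRows : ∀ a b c d → singular c d a b ≡ singular a b c d
  singular-swapRows a b c d = trans (cong₂ (λ s t → does (s ≟ t)) (*-comm c b) (*-comm d a)) (singular-swapColumns a b c d)

  factorises-swapColumns : ∀ a b c d x0 x1 x2 x3 →
    does (factorises? a b c d (x0 ∷ x1 ∷ x2 ∷ x3 ∷ [])) ≡ does (factorises? b a d c (x0 ∷ x1 ∷ x3 ∷ x2 ∷ []))
  factorises-swapColumns a b c d x0 x1 x2 x3 =
    does-⇔ (mk⇔ (λ (p , q , r , s) → q , p , s , r) (λ (q , p , s , r) → p , q , r , s))
           (factorises? a b c d (x0 ∷ x1 ∷ x2 ∷ x3 ∷ [])) (factorises? b a d c (x0 ∷ x1 ∷ x3 ∷ x2 ∷ []))

  factorises-swapRows : ∀ a b c d x0 x1 x2 x3 →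
    does (factorises? a b c d (x0 ∷ x1 ∷ x2 ∷ x3 ∷ [])) ≡ does (factorises? c d a b (x1 ∷ x0 ∷ x2 ∷ x3 ∷ []))
  factorises-swapRows a b c d x0 x1 x2 x3 =
    does-⇔ (mk⇔ (λ (p , q , r , s) → r , s , p , q) (λ (r , s , p , q) → p , q , r , s))
           (factorises? a b c d (x0 ∷ x1 ∷ x2 ∷ x3 ∷ [])) (factorises? c d a b (x1 ∷ x0 ∷ x2 ∷ x3 ∷ []))

  #factorisations-swapColumns : ∀ a b c d → #factorisations a b c d ≡ #factorisations b a d c
  #factorisations-swapColumns a b c d = ∑ₓ-cong λ x0 → ∑ₓ-cong λ x1 → trans
    (count-cong 2 {P = λ v → does (factorises? a b c d (x0 ∷ x1 ∷ v))}
                  {Q = λ v → does (factorises? b a d c (x0 ∷ x1 ∷ swap₀₁ v))}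
                  λ { (x2 ∷ x3 ∷ []) → factorises-swapColumns a b c d x0 x1 x2 x3 })
    (∑ᵛ-swap₀₁ 0 (λ v → toℕ (does (factorises? b a d c (x0 ∷ x1 ∷ v)))))

  #factorisations-swapRows : ∀ a b c d → #factorisations a b c d ≡ #factorisations c d a b
  #factorisations-swapRows a b c d = trans
    (count-cong 4 {P = does ∘ factorises? a b c d} {Q = does ∘ factorises? c d a b ∘ swap₀₁}
                  λ { (x0 ∷ x1 ∷ x2 ∷ x3 ∷ []) → factorises-swapRows a b c d x0 x1 x2 x3 })
    (∑ᵛ-swap₀₁ 2 (toℕ ∘ does ∘ factorises? c d a b))

  -- With a ≠ 0 a solution has x0 ≠ 0, and then x2, x3 and x1 are forced in turn.
  #factorisations-a≢0 : ∀ {a b c d} → a ≢ 0# → #factorisations a b c d ≡ (size ℕ.∸ 1) ℕ.* toℕ (singular a b c d)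
  #factorisations-a≢0 {a} {b} {c} {d} a≢0 with inverse a a≢0
  ... | a⁻¹ , aa⁻¹≡1 = ∑ₓ-punctured 0# _ (∑ᵛ-zero {3} no-solution-with-x0≡0) unique-solution
    where
    no-solution-with-x0≡0 : ∀ v → toℕ (does (factorises? a b c d (0# ∷ v))) ≡ 0
    no-solution-with-x0≡0 (x1 ∷ x2 ∷ x3 ∷ []) = cong toℕ (dec-false (factorises? a b c d (0# ∷ x1 ∷ x2 ∷ x3 ∷ []))
      (λ (0x2≡a , _) → a≢0 (trans (sym 0x2≡a) (zeroˡ x2))))

    unique-solution : ∀ x0 → x0 ≢ 0# → count 3 (λ v → does (factorises? a b c d (x0 ∷ v))) ≡ toℕ (singular a b c d)
    unique-solution x0 x0≢0 with inverse x0 x0≢0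
    ... | x0⁻¹ , x0x0⁻¹≡1 =
      trans (∑ᵛ-support v₀ other-v) (cong toℕ (does-⇔ at-v₀ (factorises? a b c d (x0 ∷ v₀)) ((a * d) ≟ (b * c))))
      where
      v₀ : Vec Carrier 3
      v₀ = (x0 * a⁻¹) * c ∷ x0⁻¹ * a ∷ x0⁻¹ * b ∷ []

      solution⇒v₀ : ∀ v → Factorises a b c d (x0 ∷ v) → v ≡ v₀
      solution⇒v₀ (x1 ∷ x2 ∷ x3 ∷ []) (x0x2≡a , x0x3≡b , x1x2≡c , _) =
        cong₂ _∷_ x1≡ (cong₂ _∷_ x2≡ (cong (_∷ []) (Equivalence.to (unit-solve x0x0⁻¹≡1) x0x3≡b)))
        where
        x2≡ : x2 ≡ x0⁻¹ * a
        x2≡ = Equivalence.to (unit-solve x0x0⁻¹≡1) x0x2≡a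
        x2-unit : x2 * (x0 * a⁻¹) ≡ 1#
        x2-unit = begin
          x2 * (x0 * a⁻¹)             ≡⟨ cong (_* (x0 * a⁻¹)) x2≡ ⟩
          (x0⁻¹ * a) * (x0 * a⁻¹)     ≡⟨ solve 4 (λ x0 x0⁻¹ a a⁻¹ → (x0⁻¹ :* a) :* (x0 :* a⁻¹) := (x0 :* x0⁻¹) :* (a :* a⁻¹))
                                                  refl x0 x0⁻¹ a a⁻¹ ⟩
          (x0 * x0⁻¹) * (a * a⁻¹)     ≡⟨ unit-cancelˡ x0x0⁻¹≡1 (a * a⁻¹) ⟩
          a * a⁻¹                     ≡⟨ aa⁻¹≡1 ⟩
          1#                          ∎
        x1≡ : x1 ≡ (x0 * a⁻¹) * c
        x1≡ = Equivalence.to (unit-solve x2-unit) (trans (*-comm x2 x1) x1x2≡c)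

      other-v : ∀ v → v ≢ v₀ → toℕ (does (factorises? a b c d (x0 ∷ v))) ≡ 0
      other-v v v≢v₀ = cong toℕ (dec-false (factorises? a b c d (x0 ∷ v)) (v≢v₀ ∘ solution⇒v₀ v))

      x1x3≡ : ((x0 * a⁻¹) * c) * (x0⁻¹ * b) ≡ a⁻¹ * (b * c)
      x1x3≡ = trans
        (solve 5 (λ x0 x0⁻¹ a⁻¹ b c → ((x0 :* a⁻¹) :* c) :* (x0⁻¹ :* b) := (x0 :* x0⁻¹) :* (a⁻¹ :* (b :* c))) refl x0 x0⁻¹ a⁻¹ b c)
        (unit-cancelˡ x0x0⁻¹≡1 (a⁻¹ * (b * c)))
      x1x2≡ : ((x0 * a⁻¹) * c) * (x0⁻¹ * a) ≡ c
      x1x2≡ = trans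
        (solve 5 (λ x0 x0⁻¹ a a⁻¹ c → ((x0 :* a⁻¹) :* c) :* (x0⁻¹ :* a) := (x0 :* x0⁻¹) :* ((a :* a⁻¹) :* c)) refl x0 x0⁻¹ a a⁻¹ c)
        (trans (unit-cancelˡ x0x0⁻¹≡1 ((a * a⁻¹) * c)) (unit-cancelˡ aa⁻¹≡1 c))

      x0-cancel : ∀ z → x0 * (x0⁻¹ * z) ≡ z
      x0-cancel z = Equivalence.from (unit-solve {x0} {x0⁻¹} {x0⁻¹ * z} {z} x0x0⁻¹≡1) refl

      at-v₀ : Factorises a b c d (x0 ∷ v₀) ⇔ a * d ≡ b * c
      at-v₀ = mk⇔ to from
        where
        to : Factorises a b c d (x0 ∷ v₀) → a * d ≡ b * c
        to (_ , _ , _ , x1x3≡d) = Equivalence.from (unit-solve {a} {a⁻¹} {d} {b * c} aa⁻¹≡1) (trans (sym x1x3≡d) x1x3≡)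
        from : a * d ≡ b * c → Factorises a b c d (x0 ∷ v₀)
        from ad≡bc =
          x0-cancel a , x0-cancel b , x1x2≡ , trans x1x3≡ (sym (Equivalence.to (unit-solve {a} {a⁻¹} {d} {b * c} aa⁻¹≡1) ad≡bc))

  #factorisations≡ : ∀ a b c d → ¬ (a ≡ 0# × b ≡ 0# × c ≡ 0# × d ≡ 0#) →
                     #factorisations a b c d ≡ (size ℕ.∸ 1) ℕ.* toℕ (singular a b c d)
  #factorisations≡ a b c d M≢0 with a ≟ 0# | b ≟ 0# | c ≟ 0# | d ≟ 0#
  ... | no a≢0 | _ | _ | _ = #factorisations-a≢0 a≢0
  ... | yes _ | no b≢0 | _ | _ = begin
    #factorisations a b c d                      ≡⟨ #factorisations-swapColumns a b c d ⟩
    #factorisations b a d c                      ≡⟨ #factorisations-a≢0 b≢0 ⟩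
    (size ℕ.∸ 1) ℕ.* toℕ (singular b a d c)      ≡⟨ cong (((size ℕ.∸ 1) ℕ.*_) ∘ toℕ) (singular-swapColumns a b c d) ⟩
    (size ℕ.∸ 1) ℕ.* toℕ (singular a b c d)      ∎
  ... | yes _ | yes _ | no c≢0 | _ = begin
    #factorisations a b c d                      ≡⟨ #factorisations-swapRows a b c d ⟩
    #factorisations c d a b                      ≡⟨ #factorisations-a≢0 c≢0 ⟩
    (size ℕ.∸ 1) ℕ.* toℕ (singular c d a b)      ≡⟨ cong (((size ℕ.∸ 1) ℕ.*_) ∘ toℕ) (singular-swapRows a b c d) ⟩
    (size ℕ.∸ 1) ℕ.* toℕ (singular a b c d)      ∎
  ... | yes _ | yes _ | yes _ | no d≢0 = begin
    #factorisations a b c d                      ≡⟨ #factorisations-swapRows a b c d ⟩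
    #factorisations c d a b                      ≡⟨ #factorisations-swapColumns c d a b ⟩
    #factorisations d c b a                      ≡⟨ #factorisations-a≢0 d≢0 ⟩
    (size ℕ.∸ 1) ℕ.* toℕ (singular d c b a)      ≡⟨ cong (((size ℕ.∸ 1) ℕ.*_) ∘ toℕ)
                                                        (trans (singular-swapColumns c d a b) (singular-swapRows a b c d)) ⟩
    (size ℕ.∸ 1) ℕ.* toℕ (singular a b c d)      ∎
  ... | yes a≡0 | yes b≡0 | yes c≡0 | yes d≡0 = ⊥-elim (M≢0 (a≡0 , b≡0 , c≡0 , d≡0))

  projCount-ℙ¹ : projCount 2 (λ _ → true) ≡ 1 ℕ.+ size ℕ.* 1
  projCount-ℙ¹ = trans (projCount-suc 1 (λ _ → true)) (cong₂ ℕ._+_ (projCount-suc 0 (λ _ → true)) (∑ₓ-const 1))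

  annihilator≡0 : ∀ {x0 x1 z} → x0 ∷ x1 ∷ [] ≢ 0# ∷ 0# ∷ [] → x0 * z ≡ 0# → x1 * z ≡ 0# → z ≡ 0#
  annihilator≡0 {x0} {x1} x≢0 x0z≡0 x1z≡0 with x0 ≟ 0# | x1 ≟ 0#
  ... | no x0≢0 | _ = nonzero-cancel x0≢0 x0z≡0
  ... | yes _ | no x1≢0 = nonzero-cancel x1≢0 x1z≡0
  ... | yes refl | yes refl = ⊥-elim (x≢0 refl)

  projCount-zeroMatrix : projCount 4 (does ∘ factorises? 0# 0# 0# 0#) ≡ 2 ℕ.* size ℕ.+ 2
  projCount-zeroMatrix = begin
    projCount (2 ℕ.+ 2) (does ∘ factorises? 0# 0# 0# 0#)
      ≡⟨ projCount-fibration 2 2 1 (does ∘ factorises? 0# 0# 0# 0#) (λ _ → true) fibre ⟩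
    1 ℕ.* projCount 2 (λ _ → true) ℕ.+ projCount 2 (λ x → does (factorises? 0# 0# 0# 0# (0# ∷ 0# ∷ x)))
      ≡⟨ cong (1 ℕ.* projCount 2 (λ _ → true) ℕ.+_) (projCount-cong 2 over-origin) ⟩
    1 ℕ.* projCount 2 (λ _ → true) ℕ.+ projCount 2 (λ _ → true)
      ≡⟨ cong (λ t → 1 ℕ.* t ℕ.+ t) projCount-ℙ¹ ⟩
    1 ℕ.* (1 ℕ.+ size ℕ.* 1) ℕ.+ (1 ℕ.+ size ℕ.* 1)
      ≡⟨ arithmetic size ⟩
    2 ℕ.* size ℕ.+ 2 ∎
    where
    arithmetic : ∀ q → 1 ℕ.* (1 ℕ.+ q ℕ.* 1) ℕ.+ (1 ℕ.+ q ℕ.* 1) ≡ 2 ℕ.* q ℕ.+ 2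
    arithmetic = solve-∀
    over-origin : ∀ x → does (factorises? 0# 0# 0# 0# (0# ∷ 0# ∷ x)) ≡ true
    over-origin (x2 ∷ x3 ∷ []) =
      dec-true (factorises? 0# 0# 0# 0# (0# ∷ 0# ∷ x2 ∷ x3 ∷ [])) (zeroˡ x2 , zeroˡ x3 , zeroˡ x2 , zeroˡ x3)
    fibre : ∀ y → y ≢ 0# ∷ 0# ∷ [] → count 2 (λ x → does (factorises? 0# 0# 0# 0# (y Vec.++ x))) ≡ 1 ℕ.* toℕ true
    fibre (x0 ∷ x1 ∷ []) y≢0 = trans (∑ᵛ-support (0# ∷ 0# ∷ []) off-origin)
      (cong toℕ (dec-true (factorises? 0# 0# 0# 0# (x0 ∷ x1 ∷ 0# ∷ 0# ∷ [])) (zeroʳ x0 , zeroʳ x0 , zeroʳ x1 , zeroʳ x1)))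
      where
      off-origin : ∀ v → v ≢ 0# ∷ 0# ∷ [] → toℕ (does (factorises? 0# 0# 0# 0# (x0 ∷ x1 ∷ v))) ≡ 0
      off-origin (x2 ∷ x3 ∷ []) v≢0 = cong toℕ (dec-false (factorises? 0# 0# 0# 0# (x0 ∷ x1 ∷ x2 ∷ x3 ∷ [])) λ
        (x0x2≡0 , x0x3≡0 , x1x2≡0 , x1x3≡0) →
          v≢0 (cong₂ _∷_ (annihilator≡0 y≢0 x0x2≡0 x1x2≡0) (cong (_∷ []) (annihilator≡0 y≢0 x0x3≡0 x1x3≡0))))

module FermatFibration (K : FiniteField) (½ : FiniteField.Carrier K)
                       (2½≡1 : FiniteField._*_ K (FiniteField.2# K) ½ ≡ FiniteField.1# K) where
  open FiniteField K
  open PointCounting K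
  open FieldLemmas K
  open Factorisations K
  open import Algebra.Properties.Group (CommutativeRing.+-group commutativeRing) using (x∙y⁻¹≈ε⇒x≈y; x≈y⇒x∙y⁻¹≈ε)
  open ≡-Reasoning

  ¼ : Carrier
  ¼ = ½ * ½

  halves : ∀ z → (2# * ½) * ((2# * ½) * z) ≡ z
  halves z = trans (unit-cancelˡ 2½≡1 _) (unit-cancelˡ 2½≡1 z)

  sum-difference⇔ : ∀ s t u v → (s ≡ 2# * (u + v) × t ≡ 2# * (u - v)) ⇔ (u ≡ ¼ * (s + t) × v ≡ ¼ * (s - t))
  sum-difference⇔ s t u v = mk⇔ to from
    where
    to : s ≡ 2# * (u + v) × t ≡ 2# * (u - v) → u ≡ ¼ * (s + t) × v ≡ ¼ * (s - t)
    to (refl , refl) =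
      trans (sym (halves u)) (solve 3 (λ h u v → (con (2 , 0) :* h) :* ((con (2 , 0) :* h) :* u)
                                               := (h :* h) :* (con (2 , 0) :* (u :+ v) :+ con (2 , 0) :* (u :- v))) refl ½ u v) ,
      trans (sym (halves v)) (solve 3 (λ h u v → (con (2 , 0) :* h) :* ((con (2 , 0) :* h) :* v)
                                               := (h :* h) :* (con (2 , 0) :* (u :+ v) :- con (2 , 0) :* (u :- v))) refl ½ u v)
    from : u ≡ ¼ * (s + t) × v ≡ ¼ * (s - t) → s ≡ 2# * (u + v) × t ≡ 2# * (u - v)
    from (refl , refl) =
      trans (sym (halves s)) (solve 3 (λ h s t → (con (2 , 0) :* h) :* ((con (2 , 0) :* h) :* s)
                                               := con (2 , 0) :* ((h :* h) :* (s :+ t) :+ (h :* h) :* (s :- t))) refl ½ s t) ,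
      trans (sym (halves t)) (solve 3 (λ h s t → (con (2 , 0) :* h) :* ((con (2 , 0) :* h) :* t)
                                               := con (2 , 0) :* ((h :* h) :* (s :+ t) :- (h :* h) :* (s :- t))) refl ½ s t)

  -- The matrix ( a b ; c d ) that the equations of Z prescribe for (x0, x1)ᵀ (x2, x3) over y.
  a b c d : Vec Carrier 4 → Carrier
  a (y0 ∷ y1 ∷ y2 ∷ y3 ∷ []) = ¼ * (y3 ² + y2 ²)
  b (y0 ∷ y1 ∷ y2 ∷ y3 ∷ []) = ¼ * (y0 ² + y1 ²)
  c (y0 ∷ y1 ∷ y2 ∷ y3 ∷ []) = ¼ * (y0 ² - y1 ²)
  d (y0 ∷ y1 ∷ y2 ∷ y3 ∷ []) = ¼ * (y3 ² - y2 ²)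

  Zeqs-factorises : ∀ y x → Zeqs (y Vec.++ x) ≡ does (factorises? (a y) (b y) (c y) (d y) x)
  Zeqs-factorises y@(y0 ∷ y1 ∷ y2 ∷ y3 ∷ []) x@(x0 ∷ x1 ∷ x2 ∷ x3 ∷ []) = does-⇔ (mk⇔ to from)
    ((y0 ²) ≟ (2# * (x0 * x3 + x1 * x2)) ×-dec (y1 ²) ≟ (2# * (x0 * x3 - x1 * x2)) ×-dec
     (y2 ²) ≟ (2# * (x0 * x2 - x1 * x3)) ×-dec (y3 ²) ≟ (2# * (x0 * x2 + x1 * x3)))
    (factorises? (a y) (b y) (c y) (d y) x)
    where
    to : y0 ² ≡ 2# * (x0 * x3 + x1 * x2) × y1 ² ≡ 2# * (x0 * x3 - x1 * x2) ×
         y2 ² ≡ 2# * (x0 * x2 - x1 * x3) × y3 ² ≡ 2# * (x0 * x2 + x1 * x3) → Factorises (a y) (b y) (c y) (d y) x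
    to (p0 , p1 , p2 , p3) =
      let (x0x3≡ , x1x2≡) = Equivalence.to (sum-difference⇔ (y0 ²) (y1 ²) (x0 * x3) (x1 * x2)) (p0 , p1)
          (x0x2≡ , x1x3≡) = Equivalence.to (sum-difference⇔ (y3 ²) (y2 ²) (x0 * x2) (x1 * x3)) (p3 , p2)
      in x0x2≡ , x0x3≡ , x1x2≡ , x1x3≡
    from : Factorises (a y) (b y) (c y) (d y) x → y0 ² ≡ 2# * (x0 * x3 + x1 * x2) × y1 ² ≡ 2# * (x0 * x3 - x1 * x2) ×
                                                 y2 ² ≡ 2# * (x0 * x2 - x1 * x3) × y3 ² ≡ 2# * (x0 * x2 + x1 * x3)
    from (x0x2≡ , x0x3≡ , x1x2≡ , x1x3≡) =
      let (p0 , p1) = Equivalence.from (sum-difference⇔ (y0 ²) (y1 ²) (x0 * x3) (x1 * x2)) (x0x3≡ , x1x2≡)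
          (p3 , p2) = Equivalence.from (sum-difference⇔ (y3 ²) (y2 ²) (x0 * x2) (x1 * x3)) (x0x2≡ , x1x3≡)
      in p0 , p1 , p2 , p3

  fermat-identity : ∀ y0 y1 y2 y3 →
    (¼ * (y0 ² + y1 ²)) * (¼ * (y0 ² - y1 ²)) - (¼ * (y3 ² + y2 ²)) * (¼ * (y3 ² - y2 ²))
      ≡ (¼ * ¼) * ((((y0 ⁴) - (y1 ⁴)) + (y2 ⁴)) - (y3 ⁴))
  fermat-identity = solve 5 (λ h y0 y1 y2 y3 →
      ((h :* h) :* (y0 :* y0 :+ y1 :* y1)) :* ((h :* h) :* (y0 :* y0 :- y1 :* y1))
        :- ((h :* h) :* (y3 :* y3 :+ y2 :* y2)) :* ((h :* h) :* (y3 :* y3 :- y2 :* y2))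
      := ((h :* h) :* (h :* h))
           :* (((((y0 :* y0) :* (y0 :* y0)) :- ((y1 :* y1) :* (y1 :* y1))) :+ ((y2 :* y2) :* (y2 :* y2)))
               :- ((y3 :* y3) :* (y3 :* y3))))
    refl ½

  ¼²-unit : (¼ * ¼) * ((2# * 2#) * (2# * 2#)) ≡ 1#
  ¼²-unit = trans
    (solve 1 (λ h → ((h :* h) :* (h :* h)) :* ((con (2 , 0) :* con (2 , 0)) :* (con (2 , 0) :* con (2 , 0)))
                    := (con (2 , 0) :* h) :* ((con (2 , 0) :* h) :* ((con (2 , 0) :* h) :* ((con (2 , 0) :* h) :* con (1 , 0)))))
             refl ½)
    (trans (halves _) (halves 1#))

  singular≡Feqs : ∀ y → singular (a y) (b y) (c y) (d y) ≡ Feqs y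
  singular≡Feqs y@(y0 ∷ y1 ∷ y2 ∷ y3 ∷ []) = does-⇔ (mk⇔ to from) ((a y * d y) ≟ (b y * c y)) (E ≟ 0#)
    where
    E : Carrier
    E = (((y0 ⁴) - (y1 ⁴)) + (y2 ⁴)) - (y3 ⁴)
    to : a y * d y ≡ b y * c y → E ≡ 0#
    to ad≡bc = trans
      (Equivalence.to (unit-solve ¼²-unit) (trans (sym (fermat-identity y0 y1 y2 y3)) (x≈y⇒x∙y⁻¹≈ε (sym ad≡bc))))
      (zeroʳ _)
    from : E ≡ 0# → a y * d y ≡ b y * c y
    from E≡0 = sym (x∙y⁻¹≈ε⇒x≈y _ _ (trans (fermat-identity y0 y1 y2 y3) (trans (cong ((¼ * ¼) *_) E≡0) (zeroʳ _))))

  entries≢0 : ∀ y → y ≢ replicate 4 0# → ¬ (a y ≡ 0# × b y ≡ 0# × c y ≡ 0# × d y ≡ 0#)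
  entries≢0 (y0 ∷ y1 ∷ y2 ∷ y3 ∷ []) y≢0 (a≡0 , b≡0 , c≡0 , d≡0) =
    let (y0²≡0 , y1²≡0) = both≡0 (y0 ²) (y1 ²) b≡0 c≡0
        (y3²≡0 , y2²≡0) = both≡0 (y3 ²) (y2 ²) a≡0 d≡0
    in y≢0 (cong₂ _∷_ (square≡0⇒≡0 y0²≡0) (cong₂ _∷_ (square≡0⇒≡0 y1²≡0)
             (cong₂ _∷_ (square≡0⇒≡0 y2²≡0) (cong (_∷ []) (square≡0⇒≡0 y3²≡0)))))
    where
    both≡0 : ∀ s t → ¼ * (s + t) ≡ 0# → ¼ * (s - t) ≡ 0# → s ≡ 0# × t ≡ 0#
    both≡0 s t ¼[s+t]≡0 ¼[s-t]≡0 =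
      let (s≡ , t≡) = Equivalence.from (sum-difference⇔ s t 0# 0#) (sym ¼[s+t]≡0 , sym ¼[s-t]≡0)
      in trans s≡ (solve 0 (con (2 , 0) :* (con (0 , 0) :+ con (0 , 0)) := con (0 , 0)) refl) ,
         trans t≡ (solve 0 (con (2 , 0) :* (con (0 , 0) :- con (0 , 0)) := con (0 , 0)) refl)

  count-Zfibre : ∀ y → y ≢ replicate 4 0# → count 4 (λ x → Zeqs (y Vec.++ x)) ≡ (size ℕ.∸ 1) ℕ.* toℕ (Feqs y)
  count-Zfibre y y≢0 = begin
    count 4 (λ x → Zeqs (y Vec.++ x))
      ≡⟨ count-cong 4 {Q = does ∘ factorises? (a y) (b y) (c y) (d y)} (Zeqs-factorises y) ⟩
    #factorisations (a y) (b y) (c y) (d y)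
      ≡⟨ #factorisations≡ (a y) (b y) (c y) (d y) (entries≢0 y y≢0) ⟩
    (size ℕ.∸ 1) ℕ.* toℕ (singular (a y) (b y) (c y) (d y))
      ≡⟨ cong (((size ℕ.∸ 1) ℕ.*_) ∘ toℕ) (singular≡Feqs y) ⟩
    (size ℕ.∸ 1) ℕ.* toℕ (Feqs y) ∎

  Zeqs-over-origin : ∀ x → Zeqs (replicate 4 0# Vec.++ x) ≡ does (factorises? 0# 0# 0# 0# x)
  Zeqs-over-origin x = trans (Zeqs-factorises (replicate 4 0#) x) (cong₂ (λ s t → does (factorises? s s t t x))
    (solve 1 (λ h → (h :* h) :* (con (0 , 0) :* con (0 , 0) :+ con (0 , 0) :* con (0 , 0)) := con (0 , 0)) refl ½)
    (solve 1 (λ h → (h :* h) :* (con (0 , 0) :* con (0 , 0) :- con (0 , 0) :* con (0 , 0)) := con (0 , 0)) refl ½))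

  #Z≡ : #Z ≡ (size ℕ.∸ 1) ℕ.* #F ℕ.+ 2 ℕ.* size ℕ.+ 2
  #Z≡ = begin
    #Z
      ≡⟨ projPoints≡projCount 8 Zeqs ⟩
    projCount (4 ℕ.+ 4) Zeqs
      ≡⟨ projCount-fibration 4 4 (size ℕ.∸ 1) Zeqs Feqs count-Zfibre ⟩
    (size ℕ.∸ 1) ℕ.* projCount 4 Feqs ℕ.+ projCount 4 (λ x → Zeqs (replicate 4 0# Vec.++ x))
      ≡⟨ cong₂ (λ s t → (size ℕ.∸ 1) ℕ.* s ℕ.+ t) (sym (projPoints≡projCount 4 Feqs))
               (trans (projCount-cong 4 Zeqs-over-origin) projCount-zeroMatrix) ⟩
    (size ℕ.∸ 1) ℕ.* #F ℕ.+ (2 ℕ.* size ℕ.+ 2)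
      ≡⟨ ℕ.+-assoc ((size ℕ.∸ 1) ℕ.* #F) (2 ℕ.* size) 2 ⟨
    (size ℕ.∸ 1) ℕ.* #F ℕ.+ 2 ℕ.* size ℕ.+ 2 ∎

open import Data.Nat using (ℕ; _+_; _*_; _∸_; _^_; _≥_)

prime∣^⇒∣ : ∀ {q} → Prime q → ∀ p k → q ∣ p ^ k → q ∣ p
prime∣^⇒∣ q-prime p zero q∣1 with refl ← ∣1⇒≡1 q∣1 = ⊥-elim (¬prime[1] q-prime)
prime∣^⇒∣ q-prime p (suc k) q∣p^k+1 with euclidsLemma p (p ^ k) q-prime q∣p^k+1
... | inj₁ q∣p = q∣p
... | inj₂ q∣p^k = prime∣^⇒∣ q-prime p k q∣p^k

oddPrime^k≢2*m : ∀ {p} → Prime p → p ≢ 2 → ∀ k m → p ^ k ≢ 2 * m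
oddPrime^k≢2*m {p} p-prime p≢2 k m p^k≡2*m
  with prime⇒irreducible p-prime (prime∣^⇒∣ prime[2] p k (divides m (trans p^k≡2*m (ℕ.*-comm 2 m))))
... | inj₁ ()
... | inj₂ 2≡p = p≢2 (sym 2≡p)

oddPrimePowerSize⇒#Z≡ : ∀ (K : FiniteField) {p} k → Prime p → p ≢ 2 → FiniteField.size K ≡ p ^ k →
  FiniteField.#Z K ≡ (FiniteField.size K ∸ 1) * FiniteField.#F K + 2 * FiniteField.size K + 2
oddPrimePowerSize⇒#Z≡ K k p-prime p≢2 size≡p^k =
  uncurry (FermatFibration.#Z≡ K) (FiniteField.inverse K (FiniteField.2# K) (FieldLemmas.2≢0 K size-odd))
  where
  size-odd : ∀ m → FiniteField.size K ≢ 2 * m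
  size-odd m size≡2*m = oddPrime^k≢2*m p-prime p≢2 k m (trans (sym size≡p^k) size≡2*m)

corollary3p3 : (K : FiniteField) (p k : ℕ) → Prime p → ¬ (p ≡ 2) → k ≥ 1
    → FiniteField.size K ≡ p ^ k
    → FiniteField.#Z K ≡ (p ^ k ∸ 1) * FiniteField.#F K + 2 * p ^ k + 2
corollary3p3 K p k p-prime p≢2 _ size≡p^k =
  subst (λ q → FiniteField.#Z K ≡ (q ∸ 1) * FiniteField.#F K + 2 * q + 2) size≡p^k
        (oddPrimePowerSize⇒#Z≡ K k p-prime p≢2 size≡p^k)
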